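{- Let $\mathbf{x}$ be an infinite word that is $P$-power-free for some integer $P\ge1$, and let $\boldsymbol{\tau}=(\tau_n\colon\mathcal{A}_{n+1}^*\to\mathcal{A}_n^*,\ a_n\in\mathcal{A}_n)_{n\ge0}$ be a congenial sequence generating $\mathbf{x}$ satisfying: (P) there exists $k\in\mathbb{N}$ such that $\tau_{n,n+k}$ is positive for all $n\ge0$; (F) the set $\{\tau_n:n\ge0\}$ is finite; (D) for every $n\ge0$, $\tau_n$ is decisive in $\mathbf{x}^{(n+1)}$. Suppose moreover there is $K>0$ such that $|\tau_n(a)|\le K$ for all $n\ge0$, $a\in\mathcal{A}_{n+1}$, and $|\mathcal{A}_n|\le K$ for all $n\ge0$, and such that $|\tau_{0,n}(a)|\le K\,|\tau_{0,n}(b)|$ for all $n\ge1$ and $a,b\in\mathcal{A}_n$. Let $\mathbf{x}^{(n)}$ denote the limit of $(\tau_{n,m}(a_m))_{m>n}$, and suppose there is a sequence $(B_n)_{n\ge0}$ such that $\mathbf{x}^{(n)}$ is $B_n$-letter-balanced for all $n$. Then $\mathbf{x}$ is factor-balanced. Moreover, if $(B_n)_{n\ge0}$ is bounded, then $\mathbf{x}$ is uniformly factor-balanced.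
   Context: A word is $P$-power-free if none of its factors has the form $w^P$ with $w$ nonempty. Congenial sequences: $\mathcal{A}_n$ finite alphabets, $\tau_n$ substitutions, $a_n\in\mathcal{A}_n$ with $\tau_n(a_{n+1})$ beginning with $a_n$; $\tau_{m,n}=\tau_m\circ\cdots\circ\tau_{n-1}$ for $n>m$; $\mathbf{x}^{(m)}=\lim_n\tau_{m,n}(a_n)$ and the sequence generates $\mathbf{x}=\mathbf{x}^{(0)}$. $\tau_{m,n}$ is positive if each $b\in\mathcal{A}_m$ occurs in $\tau_{m,n}(a)$ for each $a\in\mathcal{A}_n$. A substitution $\tau\colon\mathcal{A}^*\to\mathcal{B}^*$ is $k$-decisive in $\mathbf{y}\in\mathcal{A}^{\mathbb{N}}$ if there is $r\colon\mathcal{A}\to\mathcal{B}^k$ with $\tau(b)$ beginning with $r(a)$ whenever $ab$ is a factor of $\mathbf{y}$; decisive means $k$-decisive for some $k\ge1$. With $|u|_w$ the number of (possibly overlapping) occurrences of $w$ in $u$: a word $w$ is $C$-balanced in $\mathbf{y}$ if $\big||u|_w-|v|_w\big|\le C$ for all factors $u,v$ of $\mathbf{y}$ of equal length; $\mathbf{y}$ is $C$-letter-balanced if all letters are $C$-balanced; factor-balanced if each $w$ is $C_w$-balanced for some $C_w$; uniformly factor-balanced if one $C$ works for all $w$. -}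

module Defs where

open import Data.Nat using (ℕ; zero; suc; _+_; _*_; _≤_; _<_; ∣_-_∣)
open import Data.Fin using (Fin)
open import Data.Fin.Properties using (_≟_)
open import Data.Bool using (Bool; true; false; _∧_; if_then_else_)
open import Data.List using (List; []; _∷_; length; map; upTo; concat; concatMap; replicate)
open import Data.List.Membership.Propositional using (_∈_)
open import Data.Product using (Σ; ∃; ∃-syntax; _×_; _,_)
open import Relation.Binary.PropositionalEquality using (_≡_; _≢_; subst)
open import Relation.Nullary.Decidable using (⌊_⌋)

Word : ℕ → Set
Word k = ℕ → Fin k

slice : {k : ℕ} → Word k → ℕ → ℕ → List (Fin k)
slice y i l = map (λ j → y (i + j)) (upTo l)

PrefixOf : {k : ℕ} → List (Fin k) → Word k → Set
PrefixOf u y = slice y 0 (length u) ≡ u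

pow : {A : Set} → List A → ℕ → List A
pow w P = concat (replicate P w)

PowerFree : {k : ℕ} → ℕ → Word k → Set
PowerFree P x = (w : List _) → w ≢ [] → (i : ℕ) → slice x i (P * length w) ≢ pow w P

isPrefix : {k : ℕ} → List (Fin k) → List (Fin k) → Bool
isPrefix [] _ = true
isPrefix (_ ∷ _) [] = false
isPrefix (a ∷ w) (b ∷ u) = ⌊ a ≟ b ⌋ ∧ isPrefix w u

-- |u|_w : number of (possibly overlapping) occurrences of w in u
occ : {k : ℕ} → List (Fin k) → List (Fin k) → ℕ
occ w [] = if isPrefix w [] then 1 else 0
occ w (b ∷ u) = (if isPrefix w (b ∷ u) then 1 else 0) + occ w u

Balanced : {k : ℕ} → ℕ → List (Fin k) → Word k → Set
Balanced C w y = (i j l : ℕ) → ∣ occ w (slice y i l) - occ w (slice y j l) ∣ ≤ C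

LetterBalanced : {k : ℕ} → ℕ → Word k → Set
LetterBalanced C y = (a : Fin _) → Balanced C (a ∷ []) y

FactorBalanced : {k : ℕ} → Word k → Set
FactorBalanced y = (w : List _) → ∃[ C ] Balanced C w y

UniformlyFactorBalanced : {k : ℕ} → Word k → Set
UniformlyFactorBalanced y = ∃[ C ] ((w : List _) → Balanced C w y)

-- Sequences of substitutions.  Alphabet A_n = Fin (A n);
-- τ n : A_{n+1} → A_n^*  (a substitution, i.e. non-erasing morphism, given on letters)

Subst : (A : ℕ → ℕ) → Set
Subst A = (n : ℕ) → Fin (A (suc n)) → List (Fin (A n))

apply : {p q : ℕ} → (Fin p → List (Fin q)) → List (Fin p) → List (Fin q)
apply σ w = concatMap σ w

-- comp τ m d = τ_{m, m+d} = τ_m ∘ ... ∘ τ_{m+d-1}  acting on words over A_{d+m}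
comp : {A : ℕ → ℕ} → Subst A → (m d : ℕ) → List (Fin (A (d + m))) → List (Fin (A m))
comp τ m zero w = w
comp τ m (suc d) w = comp τ m d (apply (τ (d + m)) w)

NonErasing : {A : ℕ → ℕ} → Subst A → Set
NonErasing τ = (n : ℕ) (a : Fin _) → τ n a ≢ []

Congenial : {A : ℕ → ℕ} → Subst A → ((n : ℕ) → Fin (A n)) → Set
Congenial τ a = (n : ℕ) → ∃[ t ] (τ n (a (suc n)) ≡ a n ∷ t)

-- X n = x^{(n)} = lim_{m>n} τ_{n,m}(a_m): every τ_{n,m}(a_m) (m = n+d+1) is a prefix
-- of X n, and these prefixes have unbounded length (so the limit is this infinite word)
Limits : {A : ℕ → ℕ} → Subst A → ((n : ℕ) → Fin (A n)) → ((n : ℕ) → Word (A n)) → Set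
Limits τ a X =
  ((n d : ℕ) → PrefixOf (comp τ n (suc d) (a (suc d + n) ∷ [])) (X n)) ×
  ((n L : ℕ) → ∃[ d ] (L ≤ length (comp τ n (suc d) (a (suc d + n) ∷ []))))

Positive : {A : ℕ → ℕ} → Subst A → ℕ → Set
Positive τ k = (n : ℕ) (a : Fin _) (b : Fin _) → b ∈ comp τ n k (a ∷ [])

-- the set {τ_n : n ≥ 0} is finite: every τ_n equals some τ_m with m < N
FiniteSet : {A : ℕ → ℕ} → Subst A → Set
FiniteSet {A} τ = ∃[ N ] ((n : ℕ) → ∃[ m ] (m < N ×
  Σ (A (suc n) ≡ A (suc m)) λ e₁ → Σ (A n ≡ A m) λ e₀ →
    ((c : Fin (A (suc n))) → map (subst Fin e₀) (τ n c) ≡ τ m (subst Fin e₁ c))))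

-- σ : A* → B* is k-decisive in y: r : A → B^k with σ(b) beginning with r(a)
-- whenever ab is a factor of y (i.e. a = y i, b = y (i+1) for some i)
KDecisive : {p q : ℕ} → ℕ → (Fin p → List (Fin q)) → Word p → Set
KDecisive {p} {q} k σ y = Σ (Fin p → List (Fin q)) λ r →
  ((a : Fin p) → length (r a) ≡ k) ×
  ((i : ℕ) → ∃[ t ] (σ (y (suc i)) ≡ Data.List._++_ (r (y i)) t))

Decisive : {p q : ℕ} → (Fin p → List (Fin q)) → Word p → Set
Decisive σ y = ∃[ k ] (1 ≤ k × KDecisive k σ y)

{-# OPTIONS --safe #-}
-- Fix a word w of length p ≥ 1 and let N be the first level at which every τ_{0,N}(c) has length
-- at least p; then every block τ_{0,N+1}(c) has length between p and K³p. The word X 0 is the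
-- concatenation of the blocks τ_{0,N+1}(Y j), Y = X (N+1), and by decisiveness of τ_N each block is
-- followed in X 0 by at least p letters depending only on Y j. So the number of occurrences of w
-- starting in the j-th block is a function F (Y j) of the letter alone. Power-freeness keeps
-- occurrences of w more than p/P apart, whence F ≤ K³P independently of w. Finally every window of
-- X 0 lies between two runs of consecutive blocks whose lengths differ by a bounded amount; letter
-- balance of Y bounds both the difference of the F-sums over runs of equally many blocks and the
-- number of surplus blocks, giving a balance constant that depends only on K, P and the
-- letter-balance constant of Y.

module Submission where

open import Defs
open import Data.Bool using (true; false; _∧_; if_then_else_)
open import Data.Bool.Properties using (∧-zeroʳ)
open import Data.Empty using (⊥; ⊥-elim)
open import Data.Fin using (Fin; punchIn) renaming (zero to fzero; suc to fsuc)
open import Data.Fin.Properties using (_≟_; punchInᵢ≢i; all?; ¬∀⟶∃¬)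
open import Data.List using (List; []; _∷_; length; _++_; take; drop; applyUpTo)
open import Data.List.Properties using (length-++; ∷-injective; map-upTo; concatMap-++; concatMap-pure; ++-assoc; ++-identityʳ)
open import Data.Nat using (ℕ; zero; suc; _+_; _*_; _∸_; _⊓_; _/_; _%_; _≤_; _<_; z≤n; s≤s; ∣_-_∣; _≤?_; _<?_; >-nonZero)
open import Data.Nat.DivMod using (m/n*n≤m; m≡m%n+[m/n]*n; m%n<n)
open import Data.Nat.Properties hiding (_≟_)
open import Algebra.Properties.CommutativeMonoid.Sum +-0-commutativeMonoid
  using (sum; sum-cong-≗; sum-remove; sum-replicate-zero; ∑-distrib-+)
open import Data.Nat.Tactic.RingSolver using (solve-∀)
open import Data.Product using (∃-syntax; _×_; _,_; proj₁; proj₂)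
open import Data.Sum using (_⊎_; inj₁; inj₂)
open import Function using (_∘_)
open import Relation.Nullary using (¬_; yes; no)
open import Relation.Unary using (Decidable)
open import Relation.Nullary.Decidable using (⌊_⌋)
open import Relation.Binary.PropositionalEquality

private
  variable
    k m : ℕ

segment : Word k → ℕ → ℕ → List (Fin k)
segment y i zero    = []
segment y i (suc l) = y i ∷ segment y (suc i) l

applyUpTo-segment : (y : Word k) (i l : ℕ) (φ : ℕ → Fin k) →
                    (∀ j → φ j ≡ y (i + j)) → applyUpTo φ l ≡ segment y i l
applyUpTo-segment y i zero    φ φ≡ = refl
applyUpTo-segment y i (suc l) φ φ≡ = cong₂ _∷_ (trans (φ≡ 0) (cong y (+-identityʳ i)))
  (applyUpTo-segment y (suc i) l (φ ∘ suc) (λ j → trans (φ≡ (suc j)) (cong y (+-suc i j))))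

slice≡segment : (y : Word k) (i l : ℕ) → slice y i l ≡ segment y i l
slice≡segment y i l = trans (map-upTo (λ j → y (i + j)) l) (applyUpTo-segment y i l _ (λ _ → refl))

length-segment : (y : Word k) (i l : ℕ) → length (segment y i l) ≡ l
length-segment y i zero    = refl
length-segment y i (suc l) = cong suc (length-segment y (suc i) l)

segment-++ : (y : Word k) (i l l′ : ℕ) → segment y i (l + l′) ≡ segment y i l ++ segment y (i + l) l′
segment-++ y i zero    l′ = cong (λ x → segment y x l′) (sym (+-identityʳ i))
segment-++ y i (suc l) l′ = cong (y i ∷_)
  (trans (segment-++ y (suc i) l l′) (cong (λ x → segment y (suc i) l ++ segment y x l′) (sym (+-suc i l))))

segment-cong : (y : Word k) (i i′ l : ℕ) → (∀ j → j < l → y (i + j) ≡ y (i′ + j)) →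
               segment y i l ≡ segment y i′ l
segment-cong y i i′ zero    agree = refl
segment-cong y i i′ (suc l) agree = cong₂ _∷_
  (trans (cong y (sym (+-identityʳ i))) (trans (agree 0 (s≤s z≤n)) (cong y (+-identityʳ i′))))
  (segment-cong y (suc i) (suc i′) l λ j j<l →
    trans (cong y (sym (+-suc i j))) (trans (agree (suc j) (s≤s j<l)) (cong y (+-suc i′ j))))

segment-≡⇒agree : (y : Word k) (i i′ l : ℕ) → segment y i l ≡ segment y i′ l →
                  ∀ j → j < l → y (i + j) ≡ y (i′ + j)
segment-≡⇒agree y i i′ (suc l) eq zero    _         =
  trans (cong y (+-identityʳ i)) (trans (proj₁ (∷-injective eq)) (cong y (sym (+-identityʳ i′))))
segment-≡⇒agree y i i′ (suc l) eq (suc j) (s≤s j<l) =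
  trans (cong y (+-suc i j))
    (trans (segment-≡⇒agree y (suc i) (suc i′) l (proj₂ (∷-injective eq)) j j<l) (cong y (sym (+-suc i′ j))))

take-segment : (y : Word k) (i l l′ : ℕ) → l′ ≤ l → take l′ (segment y i l) ≡ segment y i l′
take-segment y i l       zero     _         = refl
take-segment y i (suc l) (suc l′) (s≤s l′≤l) = cong (y i ∷_) (take-segment y (suc i) l l′ l′≤l)

drop-segment : (y : Word k) (i l o : ℕ) → drop o (segment y i l) ≡ segment y (i + o) (l ∸ o)
drop-segment y i l       zero    = cong (λ x → segment y x l) (sym (+-identityʳ i))
drop-segment y i zero    (suc o) = refl
drop-segment y i (suc l) (suc o) =
  trans (drop-segment y (suc i) l o) (cong (λ x → segment y x (l ∸ o)) (sym (+-suc i o)))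

OccursAt : List (Fin k) → Word k → ℕ → Set
OccursAt u y i = segment y i (length u) ≡ u

++-injective-length : {A : Set} (u u′ : List A) {v v′ : List A} →
                      length u ≡ length u′ → u ++ v ≡ u′ ++ v′ → u ≡ u′ × v ≡ v′
++-injective-length []      []       _  eq = refl , eq
++-injective-length (x ∷ u) (x′ ∷ u′) |u| eq with ∷-injective eq
... | refl , eq′ with ++-injective-length u u′ (suc-injective |u|) eq′
... | refl , refl = refl , refl

occursAt-++ : (u v : List (Fin k)) (y : Word k) (i : ℕ) →
              OccursAt (u ++ v) y i → OccursAt u y i × OccursAt v y (i + length u)
occursAt-++ u v y i at = ++-injective-length _ u (length-segment y i (length u)) (begin
  segment y i (length u) ++ segment y (i + length u) (length v) ≡⟨ segment-++ y i (length u) (length v) ⟨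
  segment y i (length u + length v)                             ≡⟨ cong (segment y i) (length-++ u) ⟨
  segment y i (length (u ++ v))                                 ≡⟨ at ⟩
  u ++ v                                                        ∎)
  where open ≡-Reasoning

occursAt-infix : (u : List (Fin k)) (y : Word k) (i o l : ℕ) → OccursAt u y i → o + l ≤ length u →
                 segment y (i + o) l ≡ take l (drop o u)
occursAt-infix u y i o l at o+l≤ = begin
  segment y (i + o) l                          ≡⟨ take-segment y (i + o) (length u ∸ o) l l≤ ⟨
  take l (segment y (i + o) (length u ∸ o))   ≡⟨ cong (take l) (drop-segment y i (length u) o) ⟨
  take l (drop o (segment y i (length u)))     ≡⟨ cong (take l ∘ drop o) at ⟩
  take l (drop o u)                            ∎
  where
  open ≡-Reasoning
  l≤ : l ≤ length u ∸ o
  l≤ = subst (_≤ length u ∸ o) (m+n∸m≡n o l) (∸-monoˡ-≤ o o+l≤)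

windowSum : (ℕ → ℕ) → ℕ → ℕ → ℕ
windowSum φ a zero    = 0
windowSum φ a (suc t) = φ a + windowSum φ (suc a) t

windowSum-++ : (φ : ℕ → ℕ) (a t t′ : ℕ) → windowSum φ a (t + t′) ≡ windowSum φ a t + windowSum φ (a + t) t′
windowSum-++ φ a zero    t′ = cong (λ x → windowSum φ x t′) (sym (+-identityʳ a))
windowSum-++ φ a (suc t) t′ = trans
  (cong (φ a +_) (trans (windowSum-++ φ (suc a) t t′)
                        (cong (λ x → windowSum φ (suc a) t + windowSum φ x t′) (sym (+-suc a t)))))
  (sym (+-assoc (φ a) _ _))

windowSum-last : (φ : ℕ → ℕ) (a t : ℕ) → windowSum φ a (suc t) ≡ windowSum φ a t + φ (a + t)
windowSum-last φ a t = begin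
  windowSum φ a (suc t)                          ≡⟨ cong (windowSum φ a) (+-comm 1 t) ⟩
  windowSum φ a (t + 1)                          ≡⟨ windowSum-++ φ a t 1 ⟩
  windowSum φ a t + (φ (a + t) + 0)              ≡⟨ cong (windowSum φ a t +_) (+-identityʳ _) ⟩
  windowSum φ a t + φ (a + t)                    ∎
  where open ≡-Reasoning

windowSum-cong : (φ ψ : ℕ → ℕ) (a b t : ℕ) → (∀ j → j < t → φ (a + j) ≡ ψ (b + j)) →
                 windowSum φ a t ≡ windowSum ψ b t
windowSum-cong φ ψ a b zero    agree = refl
windowSum-cong φ ψ a b (suc t) agree = cong₂ _+_
  (trans (cong φ (sym (+-identityʳ a))) (trans (agree 0 (s≤s z≤n)) (cong ψ (+-identityʳ b))))
  (windowSum-cong φ ψ (suc a) (suc b) t λ j j<t →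
    trans (cong φ (sym (+-suc a j))) (trans (agree (suc j) (s≤s j<t)) (cong ψ (+-suc b j))))

windowSum-mono-≤ : (φ : ℕ → ℕ) (a : ℕ) {t t′ : ℕ} → t ≤ t′ → windowSum φ a t ≤ windowSum φ a t′
windowSum-mono-≤ φ a {t} {t′} t≤t′ = begin
  windowSum φ a t                                       ≤⟨ m≤m+n _ _ ⟩
  windowSum φ a t + windowSum φ (a + t) (t′ ∸ t)        ≡⟨ windowSum-++ φ a t (t′ ∸ t) ⟨
  windowSum φ a (t + (t′ ∸ t))                          ≡⟨ cong (windowSum φ a) (m+[n∸m]≡n t≤t′) ⟩
  windowSum φ a t′                                      ∎
  where open ≤-Reasoning

windowSum-≤ : (φ : ℕ → ℕ) (c : ℕ) → (∀ x → φ x ≤ c) → (a t : ℕ) → windowSum φ a t ≤ t * c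
windowSum-≤ φ c φ≤c a zero    = z≤n
windowSum-≤ φ c φ≤c a (suc t) = +-mono-≤ (φ≤c a) (windowSum-≤ φ c φ≤c (suc a) t)

windowSum-≥ : (φ : ℕ → ℕ) (c : ℕ) → (∀ x → c ≤ φ x) → (a t : ℕ) → t * c ≤ windowSum φ a t
windowSum-≥ φ c c≤φ a zero    = z≤n
windowSum-≥ φ c c≤φ a (suc t) = +-mono-≤ (c≤φ a) (windowSum-≥ φ c c≤φ (suc a) t)

windowSum-*ˡ : (c : ℕ) (φ : ℕ → ℕ) (a t : ℕ) → windowSum (λ x → c * φ x) a t ≡ c * windowSum φ a t
windowSum-*ˡ c φ a zero    = sym (*-zeroʳ c)
windowSum-*ˡ c φ a (suc t) =
  trans (cong (c * φ a +_) (windowSum-*ˡ c φ (suc a) t)) (sym (*-distribˡ-+ c (φ a) _))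

windowSum-zero : (φ : ℕ → ℕ) (a t : ℕ) → (∀ j → j < t → φ (a + j) ≡ 0) → windowSum φ a t ≡ 0
windowSum-zero φ a zero    _      = refl
windowSum-zero φ a (suc t) φ≡0 = cong₂ _+_
  (trans (cong φ (sym (+-identityʳ a))) (φ≡0 0 (s≤s z≤n)))
  (windowSum-zero φ (suc a) t λ j j<t → trans (cong φ (sym (+-suc a j))) (φ≡0 (suc j) (s≤s j<t)))

windowSum-⊆ : (φ : ℕ → ℕ) (a d t L : ℕ) → d + t ≤ L → windowSum φ (a + d) t ≤ windowSum φ a L
windowSum-⊆ φ a d t L d+t≤L = begin
  windowSum φ (a + d) t                        ≤⟨ m≤n+m _ _ ⟩
  windowSum φ a d + windowSum φ (a + d) t      ≡⟨ windowSum-++ φ a d t ⟨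
  windowSum φ a (d + t)                        ≤⟨ windowSum-mono-≤ φ a d+t≤L ⟩
  windowSum φ a L                              ∎
  where open ≤-Reasoning

-- Counting occurrences

hit : List (Fin k) → Word k → ℕ → ℕ
hit w y x = if isPrefix w (segment y x (length w)) then 1 else 0

isPrefix-++ : (w u v : List (Fin k)) → length w ≤ length u → isPrefix w (u ++ v) ≡ isPrefix w u
isPrefix-++ []      u       v _           = refl
isPrefix-++ (a ∷ w) (b ∷ u) v (s≤s |w|≤) = cong (⌊ a ≟ b ⌋ ∧_) (isPrefix-++ w u v |w|≤)

isPrefix-short : (w u : List (Fin k)) → length u < length w → isPrefix w u ≡ false
isPrefix-short (a ∷ w) []      _           = refl
isPrefix-short (a ∷ w) (b ∷ u) (s≤s |u|<) =
  trans (cong (⌊ a ≟ b ⌋ ∧_) (isPrefix-short w u |u|<)) (∧-zeroʳ ⌊ a ≟ b ⌋)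

isPrefix⇒≡ : (w u : List (Fin k)) → length u ≡ length w → isPrefix w u ≡ true → u ≡ w
isPrefix⇒≡ []      []      _   _      = refl
isPrefix⇒≡ (a ∷ w) (b ∷ u) |u| prefix with a ≟ b
... | yes refl = cong (b ∷_) (isPrefix⇒≡ w u (suc-injective |u|) prefix)

hit-0⊎1 : (w : List (Fin k)) (y : Word k) (x : ℕ) → hit w y x ≡ 0 ⊎ hit w y x ≡ 1
hit-0⊎1 w y x with isPrefix w (segment y x (length w))
... | true  = inj₂ refl
... | false = inj₁ refl

hit≡1⇒occursAt : (w : List (Fin k)) (y : Word k) (x : ℕ) → hit w y x ≡ 1 → OccursAt w y x
hit≡1⇒occursAt w y x hit≡1 with isPrefix w (segment y x (length w)) in prefix
... | true = isPrefix⇒≡ w _ (length-segment y x (length w)) prefix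

occ-segment : (a : Fin k) (w : List (Fin k)) (y : Word k) (i l : ℕ) →
              occ (a ∷ w) (segment y i l) ≡ windowSum (hit (a ∷ w) y) i (l ∸ length w)
occ-segment a w y i zero    = cong (windowSum _ i) (sym (0∸n≡0 (length w)))
occ-segment a w y i (suc l) with length w ≤? l
... | yes |w|≤l = begin
  (if isPrefix (a ∷ w) (segment y i (suc l)) then 1 else 0) + occ (a ∷ w) (segment y (suc i) l)
    ≡⟨ cong₂ _+_ (cong (λ b → if b then 1 else 0) prefix-in-window) (occ-segment a w y (suc i) l) ⟩
  windowSum (hit (a ∷ w) y) i (suc (l ∸ length w))
    ≡⟨ cong (windowSum _ i) (+-∸-assoc 1 |w|≤l) ⟨
  windowSum (hit (a ∷ w) y) i (suc l ∸ length w) ∎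
  where
  open ≡-Reasoning
  prefix-in-window : isPrefix (a ∷ w) (segment y i (suc l)) ≡ isPrefix (a ∷ w) (segment y i (suc (length w)))
  prefix-in-window = begin
    isPrefix (a ∷ w) (segment y i (suc l))
      ≡⟨ cong (isPrefix (a ∷ w) ∘ segment y i) (m+[n∸m]≡n (s≤s |w|≤l)) ⟨
    isPrefix (a ∷ w) (segment y i (suc (length w) + (l ∸ length w)))
      ≡⟨ cong (isPrefix (a ∷ w)) (segment-++ y i (suc (length w)) _) ⟩
    isPrefix (a ∷ w) (segment y i (suc (length w)) ++ _)
      ≡⟨ isPrefix-++ (a ∷ w) _ _ (≤-reflexive (sym (length-segment y i (suc (length w))))) ⟩
    isPrefix (a ∷ w) (segment y i (suc (length w))) ∎
... | no |w|≰l = begin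
  (if isPrefix (a ∷ w) (segment y i (suc l)) then 1 else 0) + occ (a ∷ w) (segment y (suc i) l)
    ≡⟨ cong₂ _+_ (cong (λ b → if b then 1 else 0) (isPrefix-short (a ∷ w) _ too-short))
                 (occ-segment a w y (suc i) l) ⟩
  windowSum (hit (a ∷ w) y) (suc i) (l ∸ length w)
    ≡⟨ cong (windowSum _ (suc i)) (m≤n⇒m∸n≡0 (<⇒≤ (≰⇒> |w|≰l))) ⟩
  0
    ≡⟨ cong (windowSum _ i) (m≤n⇒m∸n≡0 (≰⇒> |w|≰l)) ⟨
  windowSum (hit (a ∷ w) y) i (suc l ∸ length w) ∎
  where
  open ≡-Reasoning
  too-short : length (segment y i (suc l)) < length (a ∷ w)
  too-short = subst (_< suc (length w)) (sym (length-segment y i (suc l))) (s≤s (≰⇒> |w|≰l))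

occ-[]-segment : (y : Word k) (i l : ℕ) → occ [] (segment y i l) ≡ suc l
occ-[]-segment y i zero    = refl
occ-[]-segment y i (suc l) = cong suc (occ-[]-segment y (suc i) l)

∣-∣≤ : ∀ {x y} c → x ≤ y + c → y ≤ x + c → ∣ x - y ∣ ≤ c
∣-∣≤ {x} {y} c x≤ y≤ with ∣m-n∣≡[m∸n]∨[n∸m] x y
... | inj₁ eq = subst (_≤ c) (sym eq) (subst (x ∸ y ≤_) (m+n∸m≡n y c) (∸-monoˡ-≤ y x≤))
... | inj₂ eq = subst (_≤ c) (sym eq) (subst (y ∸ x ≤_) (m+n∸m≡n x c) (∸-monoˡ-≤ x y≤))

≤+∣-∣ : ∀ x y {c} → ∣ x - y ∣ ≤ c → x ≤ y + c
≤+∣-∣ x y ∣x-y∣≤c = ≤-trans (m≤n+m∸n x y) (+-monoʳ-≤ y (≤-trans (m∸n≤∣m-n∣ x y) ∣x-y∣≤c))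

balanced-[] : (C : ℕ) (y : Word k) → Balanced C [] y
balanced-[] C y i j l = subst (_≤ C) (sym (begin
  ∣ occ [] (slice y i l) - occ [] (slice y j l) ∣
    ≡⟨ cong₂ (λ u v → ∣ occ [] u - occ [] v ∣) (slice≡segment y i l) (slice≡segment y j l) ⟩
  ∣ occ [] (segment y i l) - occ [] (segment y j l) ∣
    ≡⟨ cong₂ ∣_-_∣ (occ-[]-segment y i l) (occ-[]-segment y j l) ⟩
  ∣ suc l - suc l ∣
    ≡⟨ ∣n-n∣≡0 (suc l) ⟩
  0 ∎)) z≤n
  where open ≡-Reasoning

hit-sums⇒balanced : (C : ℕ) (a : Fin k) (w : List (Fin k)) (y : Word k) →
                    (∀ i i′ t → windowSum (hit (a ∷ w) y) i t ≤ windowSum (hit (a ∷ w) y) i′ t + C) →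
                    Balanced C (a ∷ w) y
hit-sums⇒balanced C a w y hits≤ i j l = subst₂ (λ u v → ∣ u - v ∣ ≤ C)
  (sym (occurrences i)) (sym (occurrences j)) (∣-∣≤ C (hits≤ i j (l ∸ length w)) (hits≤ j i (l ∸ length w)))
  where
  occurrences : ∀ i → occ (a ∷ w) (slice y i l) ≡ windowSum (hit (a ∷ w) y) i (l ∸ length w)
  occurrences i = trans (cong (occ (a ∷ w)) (slice≡segment y i l)) (occ-segment a w y i l)

δ : Fin m → Fin m → ℕ
δ c b = if ⌊ c ≟ b ⌋ then 1 else 0

δ-diag : (b : Fin m) → δ b b ≡ 1
δ-diag b with b ≟ b
... | yes _  = refl
... | no b≢b = ⊥-elim (b≢b refl)

δ-punchIn : (b : Fin (suc m)) (j : Fin m) → δ (punchIn b j) b ≡ 0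
δ-punchIn b j with punchIn b j ≟ b
... | yes eq = ⊥-elim (punchInᵢ≢i b j eq)
... | no _   = refl

occ-letter-∷ : (c b : Fin m) (u : List (Fin m)) → occ (c ∷ []) (b ∷ u) ≡ δ c b + occ (c ∷ []) u
occ-letter-∷ c b u with ⌊ c ≟ b ⌋
... | true  = refl
... | false = refl

sum-mono-≤ : {f g : Fin m → ℕ} → (∀ c → f c ≤ g c) → sum f ≤ sum g
sum-mono-≤ {zero}  _   = z≤n
sum-mono-≤ {suc m} f≤g = +-mono-≤ (f≤g fzero) (sum-mono-≤ (f≤g ∘ fsuc))

sum-≤ : {f : Fin m → ℕ} (c₀ : ℕ) → (∀ c → f c ≤ c₀) → sum f ≤ m * c₀
sum-≤ {zero}  c₀ _    = z≤n
sum-≤ {suc m} c₀ f≤c₀ = +-mono-≤ (f≤c₀ fzero) (sum-≤ c₀ (f≤c₀ ∘ fsuc))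

sum-*δ : (f : Fin m → ℕ) (b : Fin m) → sum (λ c → f c * δ c b) ≡ f b
sum-*δ {suc m} f b = begin
  sum (λ c → f c * δ c b)                                        ≡⟨ sum-remove {i = b} (λ c → f c * δ c b) ⟩
  f b * δ b b + sum (λ j → f (punchIn b j) * δ (punchIn b j) b)  ≡⟨ cong₂ _+_ diagonal off-diagonal ⟩
  f b + 0                                                        ≡⟨ +-identityʳ (f b) ⟩
  f b                                                            ∎
  where
  open ≡-Reasoning
  diagonal : f b * δ b b ≡ f b
  diagonal = trans (cong (f b *_) (δ-diag b)) (*-identityʳ (f b))
  off-diagonal : sum (λ j → f (punchIn b j) * δ (punchIn b j) b) ≡ 0
  off-diagonal = trans (sum-cong-≗ (λ j → trans (cong (f (punchIn b j) *_) (δ-punchIn b j)) (*-zeroʳ (f (punchIn b j)))))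
                       (sum-replicate-zero m)

windowSum-letters : (Y : Word m) (f : Fin m → ℕ) (a t : ℕ) →
                    windowSum (f ∘ Y) a t ≡ sum (λ c → f c * occ (c ∷ []) (segment Y a t))
windowSum-letters {m} Y f a zero =
  sym (trans (sum-cong-≗ (λ c → *-zeroʳ (f c))) (sum-replicate-zero m))
windowSum-letters Y f a (suc t) = begin
  f (Y a) + windowSum (f ∘ Y) (suc a) t
    ≡⟨ cong₂ _+_ (sym (sum-*δ f (Y a))) (windowSum-letters Y f (suc a) t) ⟩
  sum (λ c → f c * δ c (Y a)) + sum (λ c → f c * occ (c ∷ []) (segment Y (suc a) t))
    ≡⟨ ∑-distrib-+ (λ c → f c * δ c (Y a)) _ ⟨
  sum (λ c → f c * δ c (Y a) + f c * occ (c ∷ []) (segment Y (suc a) t))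
    ≡⟨ sum-cong-≗ (λ c → trans (sym (*-distribˡ-+ (f c) _ _)) (cong (f c *_) (sym (occ-letter-∷ c (Y a) (segment Y (suc a) t))))) ⟩
  sum (λ c → f c * occ (c ∷ []) (segment Y a (suc t))) ∎
  where open ≡-Reasoning

windowSum-balanced : (Y : Word m) (B : ℕ) → LetterBalanced B Y →
                     (f : Fin m → ℕ) (c₀ : ℕ) → (∀ c → f c ≤ c₀) →
                     ∀ a a′ t → windowSum (f ∘ Y) a t ≤ windowSum (f ∘ Y) a′ t + m * (c₀ * B)
windowSum-balanced {m} Y B balanced f c₀ f≤c₀ a a′ t = begin
  windowSum (f ∘ Y) a t
    ≡⟨ windowSum-letters Y f a t ⟩
  sum (λ c → f c * count a c)
    ≤⟨ sum-mono-≤ (λ c → *-monoʳ-≤ (f c) (letter-balanced c)) ⟩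
  sum (λ c → f c * (count a′ c + B))
    ≡⟨ sum-cong-≗ (λ c → *-distribˡ-+ (f c) (count a′ c) B) ⟩
  sum (λ c → f c * count a′ c + f c * B)
    ≡⟨ ∑-distrib-+ (λ c → f c * count a′ c) (λ c → f c * B) ⟩
  sum (λ c → f c * count a′ c) + sum (λ c → f c * B)
    ≤⟨ +-mono-≤ (≤-reflexive (sym (windowSum-letters Y f a′ t))) (sum-≤ (c₀ * B) (λ c → *-monoˡ-≤ B (f≤c₀ c))) ⟩
  windowSum (f ∘ Y) a′ t + m * (c₀ * B) ∎
  where
  open ≤-Reasoning
  count : ℕ → Fin m → ℕ
  count x c = occ (c ∷ []) (segment Y x t)
  letter-balanced : ∀ c → count a c ≤ count a′ c + B
  letter-balanced c = ≤+∣-∣ (count a c) (count a′ c)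
    (subst₂ (λ u v → ∣ occ (c ∷ []) u - occ (c ∷ []) v ∣ ≤ B)
            (slice≡segment Y a t) (slice≡segment Y a′ t) (balanced c a a′ t))

-- Windows cut into blocks

locate : (h : ℕ → ℕ) → (∀ q → 1 ≤ h q) →
         ∀ a y → ∃[ s ] (windowSum h a s ≤ y × y < windowSum h a (suc s))
locate h 1≤h a zero    = 0 , z≤n , ≤-trans (1≤h a) (m≤m+n (h a) 0)
locate h 1≤h a (suc y) with locate h 1≤h a y
... | s , ≤y , y< with suc y <? windowSum h a (suc s)
...   | yes y+1< = s , m≤n⇒m≤1+n ≤y , y+1<
...   | no  y+1≮ = suc s , ≤-reflexive (sym at-boundary) , (begin-strict
  suc y                                  ≡⟨ at-boundary ⟩
  windowSum h a (suc s)                  <⟨ m<m+n _ (1≤h (a + suc s)) ⟩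
  windowSum h a (suc s) + h (a + suc s)  ≡⟨ windowSum-last h a (suc s) ⟨
  windowSum h a (suc (suc s))            ∎)
  where
  open ≤-Reasoning
  at-boundary : suc y ≡ windowSum h a (suc s)
  at-boundary = ≤-antisym y< (≮⇒≥ y+1≮)

maxExtraBlocks : ℕ → ℕ → ℕ
maxExtraBlocks K B = K * (K * (K * B) + 3 * K)

blockBalanceConstant : ℕ → ℕ → ℕ → ℕ
blockBalanceConstant K B Fₘ = Fₘ + (K * (Fₘ * B) + maxExtraBlocks K B * Fₘ)

module Blocks {m : ℕ} (Y : Word m) (ℓ F : Fin m → ℕ) (g : ℕ → ℕ) (K B Fₘ : ℕ)
  (m≤K : m ≤ K) (Y-balanced : LetterBalanced B Y)
  (1≤ℓ : ∀ b → 1 ≤ ℓ b) (ℓ-ratio : ∀ b c → ℓ b ≤ K * ℓ c) (F≤Fₘ : ∀ b → F b ≤ Fₘ)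
  (g-block : ∀ j → windowSum g (windowSum (ℓ ∘ Y) 0 j) (ℓ (Y j)) ≡ F (Y j))
  where

  private
    ℓY FY : ℕ → ℕ
    ℓY = ℓ ∘ Y
    FY = F ∘ Y

    pos : ℕ → ℕ
    pos = windowSum ℓY 0

    M : ℕ
    M = K * ℓ (Y 0)

    ℓ≤M : ∀ b → ℓ b ≤ M
    ℓ≤M b = ℓ-ratio b (Y 0)

    C′ : ℕ
    C′ = K * (Fₘ * B) + maxExtraBlocks K B * Fₘ

  g-over-blocks : ∀ a t → windowSum g (pos a) (windowSum ℓY a t) ≡ windowSum FY a t
  g-over-blocks a zero    = refl
  g-over-blocks a (suc t) = begin
    windowSum g (pos a) (ℓY a + windowSum ℓY (suc a) t)
      ≡⟨ windowSum-++ g (pos a) (ℓY a) _ ⟩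
    windowSum g (pos a) (ℓY a) + windowSum g (pos a + ℓY a) (windowSum ℓY (suc a) t)
      ≡⟨ cong₂ _+_ (g-block a) (cong (λ x → windowSum g x (windowSum ℓY (suc a) t)) (sym (windowSum-last ℓY 0 a))) ⟩
    FY a + windowSum g (pos (suc a)) (windowSum ℓY (suc a) t)
      ≡⟨ cong (FY a +_) (g-over-blocks (suc a) t) ⟩
    windowSum FY a (suc t) ∎
    where open ≡-Reasoning

  weighted-balance : (f : Fin m → ℕ) (c₀ : ℕ) → (∀ b → f b ≤ c₀) →
                     ∀ a a′ t → windowSum (f ∘ Y) a t ≤ windowSum (f ∘ Y) a′ t + K * (c₀ * B)
  weighted-balance f c₀ f≤c₀ a a′ t = ≤-trans (windowSum-balanced Y B Y-balanced f c₀ f≤c₀ a a′ t)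
                                              (+-monoʳ-≤ _ (*-monoˡ-≤ (c₀ * B) m≤K))

  position-in-block : ∀ i → ∃[ a ] ∃[ d ] (pos a + d ≡ i × d < ℓY a)
  position-in-block i with locate ℓY (1≤ℓ ∘ Y) 0 i
  ... | a , pos≤i , i< with m≤n⇒∃[o]m+o≡n pos≤i
  ... | d , pos+d≡i = a , d , pos+d≡i , +-cancelˡ-< (pos a) d (ℓY a)
                        (subst₂ _<_ (sym pos+d≡i) (windowSum-last ℓY 0 a) i<)

  blocks-covering : ∀ i l → ∃[ a ] ∃[ u ] (windowSum g i l ≤ windowSum FY a u × windowSum ℓY a u ≤ l + 2 * M)
  blocks-covering i l with position-in-block i
  ... | a , d , refl , d<ℓ with locate ℓY (1≤ℓ ∘ Y) a (d + l)
  ... | s , ≤d+l , d+l< = a , suc s , covered , short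
    where
    open ≤-Reasoning
    covered : windowSum g (pos a + d) l ≤ windowSum FY a (suc s)
    covered = begin
      windowSum g (pos a + d) l                       ≤⟨ windowSum-⊆ g (pos a) d l _ (<⇒≤ d+l<) ⟩
      windowSum g (pos a) (windowSum ℓY a (suc s))    ≡⟨ g-over-blocks a (suc s) ⟩
      windowSum FY a (suc s)                          ∎
    short : windowSum ℓY a (suc s) ≤ l + 2 * M
    short = begin
      windowSum ℓY a (suc s)          ≡⟨ windowSum-last ℓY a s ⟩
      windowSum ℓY a s + ℓY (a + s)   ≤⟨ +-mono-≤ ≤d+l (ℓ≤M (Y (a + s))) ⟩
      d + l + M                       ≤⟨ +-monoˡ-≤ M (+-monoˡ-≤ l (≤-trans (<⇒≤ d<ℓ) (ℓ≤M (Y a)))) ⟩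
      M + l + M                       ≡⟨ rearrange M l ⟩
      l + 2 * M                       ∎
      where
      rearrange : ∀ M l → M + l + M ≡ l + 2 * M
      rearrange = solve-∀

  blocks-within : ∀ i l → ∃[ a ] ∃[ v ] (windowSum FY a v ≤ Fₘ + windowSum g i l × l ≤ windowSum ℓY a v + M)
  blocks-within i l with position-in-block i
  ... | a , d , refl , d<ℓ with locate ℓY (1≤ℓ ∘ Y) a (d + l)
  ... | v , ≤d+l , d+l< = a , v , covered , long
    where
    open ≤-Reasoning
    covered : windowSum FY a v ≤ Fₘ + windowSum g (pos a + d) l
    covered = begin
      windowSum FY a v                                      ≡⟨ g-over-blocks a v ⟨
      windowSum g (pos a) (windowSum ℓY a v)                ≤⟨ windowSum-mono-≤ g (pos a) ≤d+l ⟩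
      windowSum g (pos a) (d + l)                           ≡⟨ windowSum-++ g (pos a) d l ⟩
      windowSum g (pos a) d + windowSum g (pos a + d) l     ≤⟨ +-monoˡ-≤ _ (windowSum-mono-≤ g (pos a) (<⇒≤ d<ℓ)) ⟩
      windowSum g (pos a) (ℓY a) + windowSum g (pos a + d) l ≡⟨ cong (_+ windowSum g (pos a + d) l) (g-block a) ⟩
      FY a + windowSum g (pos a + d) l                      ≤⟨ +-monoˡ-≤ _ (F≤Fₘ (Y a)) ⟩
      Fₘ + windowSum g (pos a + d) l                        ∎
    long : l ≤ windowSum ℓY a v + M
    long = begin
      l                               ≤⟨ m≤n+m l d ⟩
      d + l                           ≤⟨ <⇒≤ d+l< ⟩
      windowSum ℓY a (suc v)          ≡⟨ windowSum-last ℓY a v ⟩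
      windowSum ℓY a v + ℓY (a + v)   ≤⟨ +-monoʳ-≤ _ (ℓ≤M (Y (a + v))) ⟩
      windowSum ℓY a v + M            ∎

  blocks-compare : ∀ a a′ u v → windowSum ℓY a u ≤ windowSum ℓY a′ v + 3 * M →
                   windowSum FY a u ≤ windowSum FY a′ v + C′
  blocks-compare a a′ u v short with u ≤? v
  ... | yes u≤v = begin
    windowSum FY a u                      ≤⟨ windowSum-mono-≤ FY a u≤v ⟩
    windowSum FY a v                      ≤⟨ weighted-balance F Fₘ F≤Fₘ a a′ v ⟩
    windowSum FY a′ v + K * (Fₘ * B)      ≤⟨ +-monoʳ-≤ (windowSum FY a′ v) (m≤m+n _ _) ⟩
    windowSum FY a′ v + C′                ∎
    where open ≤-Reasoning
  ... | no u≰v = begin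
    windowSum FY a u                                                     ≡⟨ cong (windowSum FY a) v+s≡u ⟨
    windowSum FY a (v + s)                                               ≡⟨ windowSum-++ FY a v s ⟩
    windowSum FY a v + windowSum FY (a + v) s                            ≤⟨ +-mono-≤ (weighted-balance F Fₘ F≤Fₘ a a′ v)
                                                                                      (windowSum-≤ FY Fₘ (F≤Fₘ ∘ Y) (a + v) s) ⟩
    windowSum FY a′ v + K * (Fₘ * B) + s * Fₘ                            ≤⟨ +-monoʳ-≤ _ (*-monoˡ-≤ Fₘ few-extra-blocks) ⟩
    windowSum FY a′ v + K * (Fₘ * B) + maxExtraBlocks K B * Fₘ           ≡⟨ +-assoc (windowSum FY a′ v) _ _ ⟩
    windowSum FY a′ v + C′                                               ∎
    where
    open ≤-Reasoning
    s = u ∸ v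
    v+s≡u : v + s ≡ u
    v+s≡u = m+[n∸m]≡n (<⇒≤ (≰⇒> u≰v))
    extra-length : windowSum ℓY (a + v) s ≤ K * (M * B) + 3 * M
    extra-length = +-cancelˡ-≤ (windowSum ℓY a v) _ _ (begin
      windowSum ℓY a v + windowSum ℓY (a + v) s         ≡⟨ windowSum-++ ℓY a v s ⟨
      windowSum ℓY a (v + s)                            ≡⟨ cong (windowSum ℓY a) v+s≡u ⟩
      windowSum ℓY a u                                  ≤⟨ short ⟩
      windowSum ℓY a′ v + 3 * M                         ≤⟨ +-monoˡ-≤ _ (weighted-balance ℓ M ℓ≤M a′ a v) ⟩
      windowSum ℓY a v + K * (M * B) + 3 * M            ≡⟨ +-assoc (windowSum ℓY a v) _ _ ⟩
      windowSum ℓY a v + (K * (M * B) + 3 * M)          ∎)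
    -- K * ℓ b ≥ ℓ (Y 0) for every block, so only boundedly many blocks fit into extra-length
    few-extra-blocks : s ≤ maxExtraBlocks K B
    few-extra-blocks = *-cancelʳ-≤ s _ (ℓ (Y 0)) {{>-nonZero (1≤ℓ (Y 0))}} (begin
      s * ℓ (Y 0)                               ≤⟨ windowSum-≥ (λ q → K * ℓY q) (ℓ (Y 0)) (λ q → ℓ-ratio (Y 0) (Y q)) (a + v) s ⟩
      windowSum (λ q → K * ℓY q) (a + v) s      ≡⟨ windowSum-*ˡ K ℓY (a + v) s ⟩
      K * windowSum ℓY (a + v) s                ≤⟨ *-monoʳ-≤ K extra-length ⟩
      K * (K * (M * B) + 3 * M)                 ≡⟨ rearrange K (ℓ (Y 0)) B ⟩
      maxExtraBlocks K B * ℓ (Y 0)              ∎)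
      where
      rearrange : ∀ K λ₀ B → K * (K * ((K * λ₀) * B) + 3 * (K * λ₀)) ≡ K * (K * (K * B) + 3 * K) * λ₀
      rearrange = solve-∀

  window-balance : ∀ i i′ l → windowSum g i l ≤ windowSum g i′ l + blockBalanceConstant K B Fₘ
  window-balance i i′ l with blocks-covering i l | blocks-within i′ l
  ... | a , u , g≤F , short | a′ , v , F≤g , long = begin
    windowSum g i l                  ≤⟨ g≤F ⟩
    windowSum FY a u                 ≤⟨ blocks-compare a a′ u v comparable ⟩
    windowSum FY a′ v + C′           ≤⟨ +-monoˡ-≤ C′ F≤g ⟩
    Fₘ + windowSum g i′ l + C′       ≡⟨ rearrange Fₘ (windowSum g i′ l) C′ ⟩
    windowSum g i′ l + (Fₘ + C′)     ∎
    where
    open ≤-Reasoning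
    rearrange : ∀ x y z → x + y + z ≡ y + (x + z)
    rearrange = solve-∀
    comparable : windowSum ℓY a u ≤ windowSum ℓY a′ v + 3 * M
    comparable = begin
      windowSum ℓY a u               ≤⟨ short ⟩
      l + 2 * M                      ≤⟨ +-monoˡ-≤ (2 * M) long ⟩
      windowSum ℓY a′ v + M + 2 * M  ≡⟨ +-assoc (windowSum ℓY a′ v) M (2 * M) ⟩
      windowSum ℓY a′ v + 3 * M      ∎

-- Occurrences in a power-free word are sparse

periodic-power : (y : Word k) (x e R : ℕ) → (∀ j → j < R → y (x + e + j) ≡ y (x + j)) →
                 ∀ Q → Q * e ≤ R + e → segment y x (Q * e) ≡ pow (segment y x e) Q
periodic-power y x e R periodic zero    _    = refl
periodic-power y x e R periodic (suc Q) Qe≤ = trans (segment-++ y x e (Q * e)) (cong (segment y x e ++_)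
  (trans (segment-cong y (x + e) x (Q * e) (λ j j< → periodic j (≤-trans j< Qe≤R)))
         (periodic-power y x e R periodic Q (≤-trans Qe≤R (m≤m+n R e)))))
  where
  Qe≤R : Q * e ≤ R
  Qe≤R = +-cancelˡ-≤ e _ _ (subst (e + Q * e ≤_) (+-comm R e) Qe≤)

module _ (P : ℕ) (1≤P : 1 ≤ P) (x : Word k) (x-free : PowerFree P x) (w : List (Fin k)) where

  hits-far-apart : ∀ i e → 1 ≤ e → P * e ≤ length w → hit w x i ≡ 1 → hit w x (i + e) ≡ 1 → ⊥
  hits-far-apart i e@(suc _) _ Pe≤ hit₁ hit₂ = x-free (segment x i e) (λ ()) i (begin
    slice x i (P * length (segment x i e))  ≡⟨ cong (slice x i ∘ (P *_)) (length-segment x i e) ⟩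
    slice x i (P * e)                        ≡⟨ slice≡segment x i (P * e) ⟩
    segment x i (P * e)                      ≡⟨ periodic-power x i e (length w) periodic P (≤-trans Pe≤ (m≤m+n _ e)) ⟩
    pow (segment x i e) P                    ∎)
    where
    open ≡-Reasoning
    periodic : ∀ j → j < length w → x (i + e + j) ≡ x (i + j)
    periodic = segment-≡⇒agree x (i + e) i (length w)
      (trans (hit≡1⇒occursAt w x (i + e) hit₂) (sym (hit≡1⇒occursAt w x i hit₁)))

  hits-≤1 : ∀ D i → P * D ≤ length w → windowSum (hit w x) i (suc D) ≤ 1
  hits-≤1 D i PD≤ with hit-0⊎1 w x i
  ... | inj₂ hit≡1 = ≤-reflexive (cong₂ _+_ hit≡1 (windowSum-zero (hit w x) (suc i) D no-later-hit))
    where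
    no-later-hit : ∀ j → j < D → hit w x (suc i + j) ≡ 0
    no-later-hit j j<D with hit-0⊎1 w x (suc i + j)
    ... | inj₁ hit≡0 = hit≡0
    ... | inj₂ hit≡1′ = ⊥-elim (hits-far-apart i (suc j) (s≤s z≤n) (≤-trans (*-monoʳ-≤ P j<D) PD≤)
                                  hit≡1 (trans (cong (hit w x) (+-suc i j)) hit≡1′))
  hits-≤1 zero     i PD≤ | inj₁ hit≡0 = ≤-trans (≤-reflexive (cong (_+ 0) hit≡0)) z≤n
  hits-≤1 (suc D′) i PD≤ | inj₁ hit≡0 = subst (λ h → h + windowSum (hit w x) (suc i) (suc D′) ≤ 1) (sym hit≡0)
    (hits-≤1 D′ (suc i) (≤-trans (*-monoʳ-≤ P (n≤1+n D′)) PD≤))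

  hits-in-window : ∀ c i L → L ≤ c * length w → windowSum (hit w x) i L ≤ c * P
  hits-in-window c i L L≤ = begin
    windowSum (hit w x) i L              ≤⟨ windowSum-mono-≤ (hit w x) i L≤cPd ⟩
    windowSum (hit w x) i (c * P * d)    ≤⟨ blocks (c * P) i ⟩
    c * P                                ∎
    where
    open ≤-Reasoning
    instance _ = >-nonZero 1≤P
    D d : ℕ
    D = length w / P
    d = suc D
    PD≤ : P * D ≤ length w
    PD≤ = subst (_≤ length w) (*-comm D P) (m/n*n≤m (length w) P)
    |w|≤ : length w ≤ d * P
    |w|≤ = begin
      length w                  ≡⟨ m≡m%n+[m/n]*n (length w) P ⟩
      length w % P + D * P      ≤⟨ +-monoˡ-≤ (D * P) (<⇒≤ (m%n<n (length w) P)) ⟩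
      d * P                     ∎
    L≤cPd : L ≤ c * P * d
    L≤cPd = begin
      L                 ≤⟨ L≤ ⟩
      c * length w      ≤⟨ *-monoʳ-≤ c |w|≤ ⟩
      c * (d * P)       ≡⟨ rearrange c d P ⟩
      c * P * d         ∎
      where
      rearrange : ∀ c d P → c * (d * P) ≡ c * P * d
      rearrange = solve-∀
    blocks : ∀ s i → windowSum (hit w x) i (s * d) ≤ s
    blocks zero    i = z≤n
    blocks (suc s) i = begin
      windowSum (hit w x) i (d + s * d)                            ≡⟨ windowSum-++ (hit w x) i d (s * d) ⟩
      windowSum (hit w x) i d + windowSum (hit w x) (i + d) (s * d) ≤⟨ +-mono-≤ (hits-≤1 D i PD≤) (blocks s (i + d)) ⟩
      suc s                                                         ∎

-- Substitutions

apply-apply : {p q r : ℕ} (f : Fin q → List (Fin r)) (g : Fin p → List (Fin q)) (u : List (Fin p)) →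
              apply f (apply g u) ≡ apply (apply f ∘ g) u
apply-apply f g []      = refl
apply-apply f g (c ∷ u) = trans (concatMap-++ f (g c) (apply g u)) (cong (apply f (g c) ++_) (apply-apply f g u))

length-apply-≤ : {p q : ℕ} (f : Fin p → List (Fin q)) (L : ℕ) → (∀ c → length (f c) ≤ L) →
                 (u : List (Fin p)) → length (apply f u) ≤ length u * L
length-apply-≤ f L f≤L []      = z≤n
length-apply-≤ f L f≤L (c ∷ u) = ≤-trans (≤-reflexive (length-++ (f c))) (+-mono-≤ (f≤L c) (length-apply-≤ f L f≤L u))

length-apply-≥ : {p q : ℕ} (f : Fin p → List (Fin q)) (L : ℕ) → (∀ c → L ≤ length (f c)) →
                 (u : List (Fin p)) → u ≢ [] → L ≤ length (apply f u)
length-apply-≥ f L L≤f []      u≢[] = ⊥-elim (u≢[] refl)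
length-apply-≥ f L L≤f (c ∷ u) _    = ≤-trans (L≤f c) (≤-trans (m≤m+n _ _) (≤-reflexive (sym (length-++ (f c)))))

length-apply-segment : {p q : ℕ} (f : Fin p → List (Fin q)) (Y : Word p) (a t : ℕ) →
                       length (apply f (segment Y a t)) ≡ windowSum (length ∘ f ∘ Y) a t
length-apply-segment f Y a zero    = refl
length-apply-segment f Y a (suc t) = trans (length-++ (f (Y a))) (cong (length (f (Y a)) +_) (length-apply-segment f Y (suc a) t))

module _ {A : ℕ → ℕ} (τ : Subst A) where

  -- σ n is τ_{0,n} on letters
  σ : (n : ℕ) → Fin (A n) → List (Fin (A 0))
  σ zero    b = b ∷ []
  σ (suc n) b = apply (σ n) (τ n b)

  apply-σ-comp : ∀ m d (u : List (Fin (A (d + m)))) → apply (σ m) (comp τ m d u) ≡ apply (σ (d + m)) u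
  apply-σ-comp m zero    u = refl
  apply-σ-comp m (suc d) u = trans (apply-σ-comp m d (apply (τ (d + m)) u)) (apply-apply (σ (d + m)) (τ (d + m)) u)

  comp≡σ : ∀ d (b : Fin (A (d + 0))) → comp τ 0 d (b ∷ []) ≡ σ (d + 0) b
  comp≡σ d b = trans (sym (concatMap-pure _)) (trans (apply-σ-comp 0 d (b ∷ [])) (++-identityʳ _))

prefixOf⇒occursAt : {u : List (Fin k)} {y : Word k} → PrefixOf u y → OccursAt u y 0
prefixOf⇒occursAt {u = u} {y} prefix = trans (sym (slice≡segment y 0 (length u))) prefix

initial⊎crossing : {Q : ℕ → Set} → Decidable Q → ∀ {N} → Q N → Q 0 ⊎ ∃[ N′ ] (¬ Q N′ × Q (suc N′))
initial⊎crossing Q? {zero}  q = inj₁ q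
initial⊎crossing Q? {suc N} q with Q? N
... | yes q′ = initial⊎crossing Q? q′
... | no ¬q  = inj₂ (N , ¬q , q)

module Construction (P : ℕ) (1≤P : 1 ≤ P) (A : ℕ → ℕ) (τ : Subst A) (a : (n : ℕ) → Fin (A n))
  (X : (n : ℕ) → Word (A n)) (non-erasing : NonErasing τ) (limits : Limits τ a X)
  (X₀-free : PowerFree P (X 0)) (decisive : (n : ℕ) → Decisive (τ n) (X (suc n)))
  (K : ℕ) (1≤K : 1 ≤ K) (τ≤K : ∀ n c → length (τ n c) ≤ K) (A≤K : ∀ n → A n ≤ K)
  (ratio : (d : ℕ) → 1 ≤ d → (b c : Fin (A (d + 0))) →
           length (comp τ 0 d (b ∷ [])) ≤ K * length (comp τ 0 d (c ∷ [])))
  where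

  ℓ : (n : ℕ) → Fin (A n) → ℕ
  ℓ n b = length (σ τ n b)

  ℓ-ratio : ∀ n (b c : Fin (A n)) → ℓ n b ≤ K * ℓ n c
  ℓ-ratio zero    b c = *-monoˡ-≤ 1 1≤K
  ℓ-ratio (suc n)     = subst (λ m → ∀ (b c : Fin (A m)) → ℓ m b ≤ K * ℓ m c) (+-identityʳ (suc n))
    λ b c → subst₂ (λ u v → length u ≤ K * length v) (comp≡σ τ (suc n) b) (comp≡σ τ (suc n) c)
                   (ratio (suc n) (s≤s z≤n) b c)

  ℓ-suc-≤ : ∀ N {L} → (∀ c → ℓ N c ≤ L) → ∀ c → ℓ (suc N) c ≤ K * L
  ℓ-suc-≤ N {L} ℓ≤L c = ≤-trans (length-apply-≤ (σ τ N) L ℓ≤L (τ N c)) (*-monoˡ-≤ L (τ≤K N c))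

  ℓ-unbounded : ∀ L → ∃[ n ] ∀ c → L ≤ ℓ n c
  ℓ-unbounded L with proj₂ limits 0 (K * L)
  ... | d , KL≤ = suc d + 0 , λ c → *-cancelˡ-≤ K {{>-nonZero 1≤K}} (begin
    K * L                                  ≤⟨ KL≤ ⟩
    length (comp τ 0 (suc d) (a′ ∷ []))    ≡⟨ cong length (comp≡σ τ (suc d) a′) ⟩
    ℓ (suc d + 0) a′                       ≤⟨ ℓ-ratio (suc d + 0) a′ c ⟩
    K * ℓ (suc d + 0) c                    ∎)
    where
    open ≤-Reasoning
    a′ = a (suc d + 0)

  σ-a-prefix : ∀ d → OccursAt (σ τ (suc d) (a (suc d))) (X 0) 0
  σ-a-prefix d = subst (λ m → OccursAt (σ τ m (a m)) (X 0) 0) (+-identityʳ (suc d))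
    (subst (λ u → OccursAt u (X 0) 0) (comp≡σ τ (suc d) (a (suc d + 0))) (prefixOf⇒occursAt (proj₁ limits 0 d)))

  σ-prefix : ∀ n j → OccursAt (apply (σ τ n) (segment (X n) 0 j)) (X 0) 0
  σ-prefix n j with proj₂ limits n j
  ... | e , j≤|U| = proj₁ (occursAt-++ _ _ (X 0) 0 (subst (λ u → OccursAt u (X 0) 0) unfold (σ-a-prefix (e + n))))
    where
    open ≡-Reasoning
    U = comp τ n (suc e) (a (suc e + n) ∷ [])
    unfold : σ τ (suc e + n) (a (suc e + n))
             ≡ apply (σ τ n) (segment (X n) 0 j) ++ apply (σ τ n) (segment (X n) j (length U ∸ j))
    unfold = begin
      σ τ (suc e + n) (a (suc e + n))                    ≡⟨ ++-identityʳ _ ⟨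
      apply (σ τ (suc e + n)) (a (suc e + n) ∷ [])       ≡⟨ apply-σ-comp τ n (suc e) (a (suc e + n) ∷ []) ⟨
      apply (σ τ n) U                                    ≡⟨ cong (apply (σ τ n)) (prefixOf⇒occursAt (proj₁ limits n e)) ⟨
      apply (σ τ n) (segment (X n) 0 (length U))         ≡⟨ cong (apply (σ τ n) ∘ segment (X n) 0) (m+[n∸m]≡n j≤|U|) ⟨
      apply (σ τ n) (segment (X n) 0 (j + (length U ∸ j)))
        ≡⟨ cong (apply (σ τ n)) (segment-++ (X n) 0 j (length U ∸ j)) ⟩
      apply (σ τ n) (segment (X n) 0 j ++ segment (X n) j (length U ∸ j))
        ≡⟨ concatMap-++ (σ τ n) (segment (X n) 0 j) _ ⟩
      apply (σ τ n) (segment (X n) 0 j) ++ apply (σ τ n) (segment (X n) j (length U ∸ j)) ∎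

  decisive-level : ∀ p → 1 ≤ p → ∃[ N ] ((∀ c → p ≤ ℓ N c) × (∀ c → ℓ (suc N) c ≤ K * (K * (K * p))))
  decisive-level p 1≤p with ℓ-unbounded p
  ... | N , long with initial⊎crossing (λ N → all? (λ c → p ≤? ℓ N c)) long
  ... | inj₁ long₀ = 0 , long₀ , ℓ-suc-≤ 0 (λ _ → *-mono-≤ 1≤K (*-mono-≤ 1≤K 1≤p))
  ... | inj₂ (N′ , not-long , long′) with ¬∀⟶∃¬ (A N′) _ (λ c → p ≤? ℓ N′ c) not-long
  ...   | c₀ , ℓc₀≱p = suc N′ , long′ , ℓ-suc-≤ (suc N′) (ℓ-suc-≤ N′ λ c →
    ≤-trans (ℓ-ratio N′ c c₀) (*-monoʳ-≤ K (<⇒≤ (≰⇒> ℓc₀≱p))))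

  maxBlockHits : ℕ
  maxBlockHits = K * (K * (K * P))

  1≤ℓ : ∀ n b → 1 ≤ ℓ n b
  1≤ℓ zero    b = s≤s z≤n
  1≤ℓ (suc n) b = length-apply-≥ (σ τ n) 1 (1≤ℓ n) (τ n b) (non-erasing n b)

  module AtLevel (w : List (Fin (A 0))) (N : ℕ)
    (long : ∀ c → length w ≤ ℓ N c) (short : ∀ c → ℓ (suc N) c ≤ K * (K * (K * length w)))
    (r : Fin (A (suc N)) → List (Fin (A N))) (r≢[] : ∀ b → r b ≢ [])
    (r-prefix : ∀ i → ∃[ t ] (τ N (X (suc N) (suc i)) ≡ r (X (suc N) i) ++ t))
    where

    private
      n = suc N
      Y = X n
      X₀ = X 0
      p = length w

      pos : ℕ → ℕ
      pos = windowSum (ℓ n ∘ Y) 0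

    extension : Fin (A n) → List (Fin (A 0))
    extension b = σ τ n b ++ apply (σ τ N) (r b)

    extension-long : ∀ b → ℓ n b + p ≤ length (extension b)
    extension-long b = subst (ℓ n b + p ≤_) (sym (length-++ (σ τ n b)))
      (+-monoʳ-≤ (ℓ n b) (length-apply-≥ (σ τ N) p long (r b) (r≢[] b)))

    extension-occurs : ∀ j → OccursAt (extension (Y j)) X₀ (pos j)
    extension-occurs j with r-prefix j
    ... | t , τY≡rt = subst (OccursAt (extension (Y j)) X₀) (length-apply-segment (σ τ n) Y 0 j)
      (proj₁ (occursAt-++ (extension (Y j)) _ X₀ _ (proj₂ (occursAt-++ (apply (σ τ n) (segment Y 0 j)) _ X₀ 0
        (subst (λ u → OccursAt u X₀ 0) unfold (σ-prefix n (j + 2)))))))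
      where
      open ≡-Reasoning
      before = apply (σ τ n) (segment Y 0 j)
      unfold : apply (σ τ n) (segment Y 0 (j + 2)) ≡ before ++ (extension (Y j) ++ apply (σ τ N) t ++ [])
      unfold = begin
        apply (σ τ n) (segment Y 0 (j + 2))
          ≡⟨ cong (apply (σ τ n)) (segment-++ Y 0 j 2) ⟩
        apply (σ τ n) (segment Y 0 j ++ Y j ∷ Y (suc j) ∷ [])
          ≡⟨ concatMap-++ (σ τ n) (segment Y 0 j) _ ⟩
        before ++ σ τ n (Y j) ++ apply (σ τ N) (τ N (Y (suc j))) ++ []
          ≡⟨ cong (λ u → before ++ σ τ n (Y j) ++ u ++ []) (trans (cong (apply (σ τ N)) τY≡rt) (concatMap-++ (σ τ N) (r (Y j)) t)) ⟩
        before ++ σ τ n (Y j) ++ (apply (σ τ N) (r (Y j)) ++ apply (σ τ N) t) ++ []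
          ≡⟨ cong (λ u → before ++ σ τ n (Y j) ++ u) (++-assoc (apply (σ τ N) (r (Y j))) _ []) ⟩
        before ++ σ τ n (Y j) ++ apply (σ τ N) (r (Y j)) ++ apply (σ τ N) t ++ []
          ≡⟨ cong (before ++_) (++-assoc (σ τ n (Y j)) _ _) ⟨
        before ++ extension (Y j) ++ apply (σ τ N) t ++ [] ∎

    extensionHits : Fin (A n) → ℕ
    extensionHits b = windowSum (λ o → if isPrefix w (take p (drop o (extension b))) then 1 else 0) 0 (ℓ n b)

    block-hits : ∀ j → windowSum (hit w X₀) (pos j) (ℓ n (Y j)) ≡ extensionHits (Y j)
    block-hits j = windowSum-cong _ _ (pos j) 0 (ℓ n (Y j)) λ o o<ℓ →
      cong (λ u → if isPrefix w u then 1 else 0)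
           (occursAt-infix (extension (Y j)) X₀ (pos j) o p (extension-occurs j)
                           (≤-trans (+-monoˡ-≤ p (<⇒≤ o<ℓ)) (extension-long (Y j))))

    block-hits-≤ : ∀ j → extensionHits (Y j) ≤ maxBlockHits
    block-hits-≤ j = subst₂ _≤_ (block-hits j) (sym (cube K P))
      (hits-in-window P 1≤P X₀ X₀-free w (K * (K * K)) (pos j) (ℓ n (Y j))
                      (subst (ℓ n (Y j) ≤_) (cube K p) (short (Y j))))
      where
      cube : ∀ K x → K * (K * (K * x)) ≡ K * (K * K) * x
      cube = solve-∀

    -- Letters that never occur in Y escape the sparsity bound, hence the cap.
    F : Fin (A n) → ℕ
    F b = extensionHits b ⊓ maxBlockHits

    window-balance : ∀ B → LetterBalanced B Y →
                     ∀ i i′ t → windowSum (hit w X₀) i t ≤ windowSum (hit w X₀) i′ t + blockBalanceConstant K B maxBlockHits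
    window-balance B Y-balanced = Blocks.window-balance Y (ℓ n) F (hit w X₀) K B maxBlockHits (A≤K n) Y-balanced
      (1≤ℓ n) (ℓ-ratio n) (λ b → m⊓n≤n (extensionHits b) maxBlockHits) (λ j → trans (block-hits j) (sym (m≤n⇒m⊓n≡m (block-hits-≤ j))))

  word-balanced : (w : List (Fin (A 0))) →
                  ∃[ n ] ∀ B → LetterBalanced B (X n) → Balanced (blockBalanceConstant K B maxBlockHits) w (X 0)
  word-balanced []        = 0 , λ B _ → balanced-[] _ (X 0)
  word-balanced (w₀ ∷ w′) with decisive-level (length (w₀ ∷ w′)) (s≤s z≤n)
  ... | N , long , short with decisive N
  ... | _ , 1≤k , r , |r|≡k , r-prefix = suc N , λ B Y-balanced →
    hit-sums⇒balanced _ w₀ w′ (X 0) (AtLevel.window-balance (w₀ ∷ w′) N long short r r≢[] r-prefix B Y-balanced)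
    where
    r≢[] : ∀ b → r b ≢ []
    r≢[] b r≡[] = <⇒≱ 1≤k (≤-reflexive (trans (sym (|r|≡k b)) (cong length r≡[])))

letterBalanced-mono : {y : Word k} {B B′ : ℕ} → B ≤ B′ → LetterBalanced B y → LetterBalanced B′ y
letterBalanced-mono B≤B′ balanced c i j l = ≤-trans (balanced c i j l) B≤B′

-- Congeniality, (P) and (F) serve in the paper only to produce the limit words and the constant K,
-- both of which are hypotheses here.
theorem5p12 : (P : ℕ) → 1 ≤ P →
    (A : ℕ → ℕ) (τ : Subst A) (a : (n : ℕ) → Fin (A n)) (X : (n : ℕ) → Word (A n)) →
    NonErasing τ → Congenial τ a → Limits τ a X →
    PowerFree P (X 0) →
    (∃[ k ] Positive τ k) →
    FiniteSet τ →
    ((n : ℕ) → Decisive (τ n) (X (suc n))) →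
    (∃[ K ] (1 ≤ K ×
      ((n : ℕ) (c : Fin (A (suc n))) → length (τ n c) ≤ K) ×
      ((n : ℕ) → A n ≤ K) ×
      ((d : ℕ) → 1 ≤ d → (b c : Fin (A (d + 0))) →
        length (comp τ 0 d (b ∷ [])) ≤ K * length (comp τ 0 d (c ∷ []))))) →
    (B : ℕ → ℕ) → ((n : ℕ) → LetterBalanced (B n) (X n)) →
    FactorBalanced (X 0) × ((∃[ M ] ((n : ℕ) → B n ≤ M)) → UniformlyFactorBalanced (X 0))
theorem5p12 P 1≤P A τ a X non-erasing _ limits X₀-free _ _ decisive (K , 1≤K , τ≤K , A≤K , ratio) B X-balanced =
  (λ w → let n , balanced = word-balanced w in _ , balanced (B n) (X-balanced n)) ,
  λ (M , B≤M) → blockBalanceConstant K M maxBlockHits , λ w →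
    let n , balanced = word-balanced w in balanced M (letterBalanced-mono {y = X n} (B≤M n) (X-balanced n))
  where
  open Construction P 1≤P A τ a X non-erasing limits X₀-free decisive K 1≤K τ≤K A≤K ratio
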